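{- Let $m$ be a positive integer and $\alpha\in\mathbb{F}_{2^m}$. Consider the triple of maps $\mathbb{F}_{2^{4m}}\to\mathbb{F}_{2^{4m}}$ $$(\Phi_1,\Phi_2,\Phi_3)=\left(x^{2^{2m}},\ \alpha x^{2^m}+(\alpha+1)x^{2^{3m}},\ (\alpha+1)x^{2^m}+\alpha x^{2^{3m}}\right).$$ Then $\Phi_1,\Phi_2,\Phi_3$ are permutations of $\mathbb{F}_{2^{4m}}$, the triple satisfies property $(\mathcal{A}_{4m})$, and $E^{\cup}\neq\mathbb{F}_{2^{4m}}$.
   Context: For a positive integer $n$ and $q=2^n$, three permutations $\Phi_1,\Phi_2,\Phi_3$ of $\mathbb{F}_q$ are said to satisfy property $(\mathcal{A}_n)$ if (1) $\Psi=\Phi_1+\Phi_2+\Phi_3$ is a permutation of $\mathbb{F}_q$, and (2) $\Psi^{ -1}=\Phi_1^{ -1}+\Phi_2^{ -1}+\Phi_3^{ -1}$ (sums are pointwise sums of functions, inverses are compositional inverses). For $1\le i<j\le 3$, $E_{i,j}=\{x\in\mathbb{F}_q:\Phi_i(x)=\Phi_j(x)\}$ and $E^{\cup}=E_{1,2}\cup E_{1,3}\cup E_{2,3}$. -}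

module Defs where

open import Data.Nat using (ℕ; zero; suc)
import Data.Nat as ℕ
open import Data.Fin using (Fin)
open import Data.Product using (Σ; ∃; _×_; _,_)
open import Data.Sum using (_⊎_)
open import Relation.Binary.PropositionalEquality using (_≡_; _≢_)
open import Algebra.Structures using (IsCommutativeRing)
open import Function.Bundles using (_↔_)

-- A finite field of characteristic 2 with exactly 2^n elements
-- (a model of F_{2^n}; all such fields are isomorphic and every
-- notion below is invariant under field isomorphism).
record GF2^ (n : ℕ) : Set₁ where
  infixl 6 _+_
  infixl 7 _*_
  field
    Carrier : Set
    _+_ _*_ : Carrier → Carrier → Carrier
    -_ : Carrier → Carrier
    0# 1# : Carrier
    isCommutativeRing : IsCommutativeRing _≡_ _+_ _*_ -_ 0# 1#
    0≢1 : 0# ≢ 1#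
    inverse : ∀ x → x ≢ 0# → ∃ λ y → x * y ≡ 1#
    char2 : 1# + 1# ≡ 0#
    card : Carrier ↔ Fin (2 ℕ.^ n)

  _^_ : Carrier → ℕ → Carrier
  x ^ zero = 1#
  x ^ suc k = x * (x ^ k)

  IsInverseOf : (Carrier → Carrier) → (Carrier → Carrier) → Set
  IsInverseOf g f = (∀ x → g (f x) ≡ x) × (∀ y → f (g y) ≡ y)

  IsPermutation : (Carrier → Carrier) → Set
  IsPermutation f = ∃ λ g → IsInverseOf g f

  -- property (A_n): Ψ = Φ₁+Φ₂+Φ₃ is a permutation and
  -- Ψ⁻¹ = Φ₁⁻¹ + Φ₂⁻¹ + Φ₃⁻¹ (pointwise); inverses are unique,
  -- so existence of inverses with this relation is the property.
  PropertyA : (Carrier → Carrier) → (Carrier → Carrier) → (Carrier → Carrier) → Set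
  PropertyA Φ₁ Φ₂ Φ₃ =
    Σ (Carrier → Carrier) λ g₁ → Σ (Carrier → Carrier) λ g₂ →
    Σ (Carrier → Carrier) λ g₃ → Σ (Carrier → Carrier) λ h →
      IsInverseOf g₁ Φ₁ × IsInverseOf g₂ Φ₂ × IsInverseOf g₃ Φ₃ ×
      IsInverseOf h (λ x → Φ₁ x + Φ₂ x + Φ₃ x) ×
      (∀ y → h y ≡ g₁ y + g₂ y + g₃ y)

  InEUnion : (Carrier → Carrier) → (Carrier → Carrier) → (Carrier → Carrier) → Carrier → Set
  InEUnion Φ₁ Φ₂ Φ₃ x = (Φ₁ x ≡ Φ₂ x) ⊎ (Φ₁ x ≡ Φ₃ x) ⊎ (Φ₂ x ≡ Φ₃ x)

-- Put σ x = x ^ 2^m. On a field with 2^(4m) elements σ is a ring endomorphism with σ⁴ = id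
-- (Fermat), and α and β = α + 1 are σ-fixed with α + β = 1. Then Φ₁ = σ², Φ₂ = α σ + β σ³ and
-- Φ₃ = β σ + α σ³, and Φ₂, Φ₃ are mutually inverse because (α + β)² = 1; hence
-- Φ₁⁻¹ + Φ₂⁻¹ + Φ₃⁻¹ = Φ₁ + Φ₂ + Φ₃ = Ψ = σ + σ² + σ³. Now Ψ = trace + id, where the trace
-- 1 + σ + σ² + σ³ is σ-invariant and so vanishes on its own image in characteristic 2; thus Ψ is an
-- involution. Finally, every coincidence set E_ij lies in the fixed field of σ², which is a proper
-- subset because X^(2^(2m)) + X has at most 2^(2m) < 2^(4m) roots.

module Submission where

open import Algebra.Bundles using (CommutativeRing)
open import Algebra.Core using (Op₁; Op₂)
open import Algebra.Structures using (IsCommutativeRing)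
open import Data.Empty using (⊥-elim)
open import Data.Fin.Base using (Fin; punchIn; punchOut) renaming (zero to fzero; suc to fsuc)
open import Data.Fin.Permutation using (Permutation; permutation)
open import Data.Fin.Properties
  using (punchIn-injective; punchInᵢ≢i; punchIn-punchOut; inj⇒≟; suc-injective; ¬∀⟶∃¬)
open import Data.Maybe.Base using (Maybe; just; nothing; map)
open import Data.Nat using (ℕ; _≤_)
import Data.Nat as ℕ
open import Data.Nat.Base using (zero; suc; z≤n; s≤s; >-nonZero)
import Data.Nat.Properties as ℕₚ
open import Data.Nat.GeneralisedArithmetic using (iterate)
open import Data.Product using (∃; _×_; _,_)
open import Data.Sum.Base using (inj₁; inj₂)
open import Data.Vec.Base using (Vec; []; _∷_; replicate)
open import Function.Bundles using (_↔_; Inverse; Injection)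
open import Function.Definitions using (Injective)
open import Function.Properties.Inverse using (↔⇒↣; ↔-sym)
open import Relation.Binary.Definitions using (DecidableEquality)
open import Relation.Nullary using (¬_; yes; no)
open import Relation.Binary.PropositionalEquality

open import Defs

module CharacteristicTwo {a} {A : Set a} {add mul : Op₂ A} {neg : Op₁ A} {0# 1# : A}
    (isCommutativeRing : IsCommutativeRing _≡_ add mul neg 0# 1#)
    (1+1≡0 : add 1# 1# ≡ 0#) where

  commutativeRing : CommutativeRing a a
  commutativeRing = record { isCommutativeRing = isCommutativeRing }

  open CommutativeRing commutativeRing public using (_+_; _*_; +-comm; +-identityˡ; *-identityˡ; *-identityʳ)
  open CommutativeRing commutativeRing using (+-assoc; semiring; commutativeSemiring)
  open import Algebra.Properties.Semiring.Mult semiring using () renaming (_×_ to _×ₙ_)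
  open import Algebra.Properties.CommutativeSemiring.Exp commutativeSemiring public
    using (_^_; ^-assocʳ; ^-distrib-*)
  open ≡-Reasoning

  ×ₙ1-period-2 : ∀ n → suc (suc n) ×ₙ 1# ≡ n ×ₙ 1#
  ×ₙ1-period-2 n = begin
    1# + (1# + n ×ₙ 1#) ≡⟨ +-assoc 1# 1# _ ⟨
    (1# + 1#) + n ×ₙ 1# ≡⟨ cong (_+ n ×ₙ 1#) 1+1≡0 ⟩
    0# + n ×ₙ 1#        ≡⟨ +-identityˡ _ ⟩
    n ×ₙ 1#             ∎

  -- Deciding numerals modulo 2 turns the natural-coefficient ring solver into a solver
  -- for identities of characteristic 2.
  ×ₙ1-≟-mod2 : ∀ m n → Maybe (m ×ₙ 1# ≡ n ×ₙ 1#)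
  ×ₙ1-≟-mod2 (suc (suc m)) n = map (trans (×ₙ1-period-2 m)) (×ₙ1-≟-mod2 m n)
  ×ₙ1-≟-mod2 m (suc (suc n)) = map (λ e → trans e (sym (×ₙ1-period-2 n))) (×ₙ1-≟-mod2 m n)
  ×ₙ1-≟-mod2 0 0 = just refl
  ×ₙ1-≟-mod2 1 1 = just refl
  ×ₙ1-≟-mod2 _ _ = nothing

  open import Algebra.Solver.Ring.NaturalCoefficients commutativeSemiring ×ₙ1-≟-mod2 public
    using (solve; _:+_; _:*_; _:=_; con)

  x+x≡0 : ∀ x → x + x ≡ 0#
  x+x≡0 = solve 1 (λ x → x :+ x := con 0) refl

  x+y≡0⇒x≡y : ∀ {x y} → x + y ≡ 0# → x ≡ y
  x+y≡0⇒x≡y {x} {y} x+y≡0 = begin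
    x            ≡⟨ solve 2 (λ x y → x := (x :+ y) :+ y) refl x y ⟩
    (x + y) + y  ≡⟨ cong (_+ y) x+y≡0 ⟩
    0# + y       ≡⟨ +-identityˡ y ⟩
    y            ∎

  1^n≡1 : ∀ n → 1# ^ n ≡ 1#
  1^n≡1 zero    = refl
  1^n≡1 (suc n) = trans (*-identityˡ _) (1^n≡1 n)

  frobenius-+ : ∀ k x y → (x + y) ^ (2 ℕ.^ k) ≡ x ^ (2 ℕ.^ k) + y ^ (2 ℕ.^ k)
  frobenius-+ zero    x y = solve 2 (λ x y → (x :+ y) :* con 1 := x :* con 1 :+ y :* con 1) refl x y
  frobenius-+ (suc k) x y = begin
    (x + y) ^ (2 ℕ.* 2 ℕ.^ k)                 ≡⟨ ^-assocʳ (x + y) 2 (2 ℕ.^ k) ⟨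
    ((x + y) ^ 2) ^ (2 ℕ.^ k)                 ≡⟨ cong (_^ (2 ℕ.^ k)) square-+ ⟩
    (x ^ 2 + y ^ 2) ^ (2 ℕ.^ k)               ≡⟨ frobenius-+ k (x ^ 2) (y ^ 2) ⟩
    (x ^ 2) ^ (2 ℕ.^ k) + (y ^ 2) ^ (2 ℕ.^ k) ≡⟨ cong₂ _+_ (^-assocʳ x 2 (2 ℕ.^ k)) (^-assocʳ y 2 (2 ℕ.^ k)) ⟩
    x ^ (2 ℕ.* 2 ℕ.^ k) + y ^ (2 ℕ.* 2 ℕ.^ k) ∎
    where
    square-+ : (x + y) ^ 2 ≡ x ^ 2 + y ^ 2
    square-+ = solve 2 (λ x y → (x :+ y) :* ((x :+ y) :* con 1) := x :* (x :* con 1) :+ y :* (y :* con 1))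
                       refl x y

  ^2^-+ : ∀ x j k → (x ^ (2 ℕ.^ j)) ^ (2 ℕ.^ k) ≡ x ^ (2 ℕ.^ (j ℕ.+ k))
  ^2^-+ x j k = trans (^-assocʳ x (2 ℕ.^ j) (2 ℕ.^ k)) (cong (x ^_) (sym (ℕₚ.^-distribˡ-+-* 2 j k)))

  module Order4Endomorphism (σ : A → A)
      (σ-+ : ∀ x y → σ (x + y) ≡ σ x + σ y)
      (σ-* : ∀ x y → σ (x * y) ≡ σ x * σ y)
      (σ⁴≡id : ∀ x → σ (σ (σ (σ x))) ≡ x) where

    σ² σ³ : A → A
    σ² x = σ (σ x)
    σ³ x = σ (σ² x)

    Fixed : A → Set a
    Fixed c = σ c ≡ c

    fixed-+ : ∀ {c d} → Fixed c → Fixed d → Fixed (c + d)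
    fixed-+ {c} {d} σc σd = trans (σ-+ c d) (cong₂ _+_ σc σd)

    σ²-involutive : ∀ x → σ² (σ² x) ≡ x
    σ²-involutive = σ⁴≡id

    trace : A → A
    trace x = x + σ x + σ² x + σ³ x

    trace-+ : ∀ x y → trace (x + y) ≡ trace x + trace y
    trace-+ x y = begin
      (x + y) + σ (x + y) + σ² (x + y) + σ³ (x + y)
        ≡⟨ cong₂ _+_ (cong₂ _+_ (cong ((x + y) +_) σ-xy) σ²-xy) σ³-xy ⟩
      (x + y) + (σ x + σ y) + (σ² x + σ² y) + (σ³ x + σ³ y)
        ≡⟨ solve 8 (λ x y a b c d e f → (x :+ y) :+ (a :+ b) :+ (c :+ d) :+ (e :+ f)
                                         := (x :+ a :+ c :+ e) :+ (y :+ b :+ d :+ f))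
                   refl x y (σ x) (σ y) (σ² x) (σ² y) (σ³ x) (σ³ y) ⟩
      trace x + trace y ∎
      where
      σ-xy = σ-+ x y
      σ²-xy = trans (cong σ σ-xy) (σ-+ (σ x) (σ y))
      σ³-xy = trans (cong σ σ²-xy) (σ-+ (σ² x) (σ² y))

    trace-fixed : ∀ x → Fixed (trace x)
    trace-fixed x = begin
      σ (x + σ x + σ² x + σ³ x)         ≡⟨ σ-+ _ _ ⟩
      σ (x + σ x + σ² x) + σ (σ³ x)     ≡⟨ cong₂ _+_ (trans (σ-+ _ _) (cong (_+ σ³ x) (σ-+ _ _))) (σ⁴≡id x) ⟩
      σ x + σ² x + σ³ x + x             ≡⟨ solve 4 (λ x a b c → a :+ b :+ c :+ x := x :+ a :+ b :+ c)
                                                   refl x (σ x) (σ² x) (σ³ x) ⟩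
      x + σ x + σ² x + σ³ x             ∎

    trace-of-fixed : ∀ {c} → Fixed c → trace c ≡ 0#
    trace-of-fixed {c} σc = begin
      c + σ c + σ (σ c) + σ (σ (σ c)) ≡⟨ cong (λ d → c + d + σ d + σ (σ d)) σc ⟩
      c + c + σ c + σ (σ c)           ≡⟨ cong (λ d → c + c + d + σ d) σc ⟩
      c + c + c + σ c                 ≡⟨ cong (c + c + c +_) σc ⟩
      c + c + c + c                   ≡⟨ solve 1 (λ c → c :+ c :+ c :+ c := con 0) refl c ⟩
      0#                              ∎

    T : A → A
    T x = σ x + σ² x + σ³ x

    T≡trace+id : ∀ x → T x ≡ trace x + x
    T≡trace+id x = solve 4 (λ x a b c → a :+ b :+ c := (x :+ a :+ b :+ c) :+ x)
                           refl x (σ x) (σ² x) (σ³ x)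

    T-involutive : ∀ x → T (T x) ≡ x
    T-involutive x = begin
      T (T x)                                   ≡⟨ T≡trace+id (T x) ⟩
      trace (T x) + T x                         ≡⟨ cong (λ y → trace y + y) (T≡trace+id x) ⟩
      trace (trace x + x) + (trace x + x)       ≡⟨ cong (_+ (trace x + x)) (trace-+ (trace x) x) ⟩
      trace (trace x) + trace x + (trace x + x) ≡⟨ cong (λ t → t + trace x + (trace x + x))
                                                         (trace-of-fixed (trace-fixed x)) ⟩
      0# + trace x + (trace x + x)              ≡⟨ solve 2 (λ t x → con 0 :+ t :+ (t :+ x) := x) refl (trace x) x ⟩
      x                                         ∎

    twist : A → A → A → A
    twist c d x = c * σ x + d * σ³ x

    module _ {c d : A} (σc : Fixed c) (σd : Fixed d) where

      σ-twist : ∀ x → σ (twist c d x) ≡ c * σ² x + d * x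
      σ-twist x = begin
        σ (c * σ x + d * σ³ x)           ≡⟨ trans (σ-+ _ _) (cong₂ _+_ (σ-* c (σ x)) (σ-* d (σ³ x))) ⟩
        σ c * σ² x + σ d * σ (σ³ x)      ≡⟨ cong₂ (λ c′ d′ → c′ * σ² x + d′ * σ (σ³ x)) σc σd ⟩
        c * σ² x + d * σ (σ³ x)          ≡⟨ cong (λ y → c * σ² x + d * y) (σ⁴≡id x) ⟩
        c * σ² x + d * x                 ∎

      σ²-twist : ∀ x → σ² (twist c d x) ≡ twist d c x
      σ²-twist x = begin
        σ (σ (twist c d x))             ≡⟨ cong σ (σ-twist x) ⟩
        σ (c * σ² x + d * x)            ≡⟨ trans (σ-+ _ _) (cong₂ _+_ (σ-* c (σ² x)) (σ-* d x)) ⟩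
        σ c * σ³ x + σ d * σ x          ≡⟨ cong₂ (λ c′ d′ → c′ * σ³ x + d′ * σ x) σc σd ⟩
        c * σ³ x + d * σ x              ≡⟨ +-comm _ _ ⟩
        twist d c x                     ∎

    twist-inverse : ∀ {c d} → c + d ≡ 1# → Fixed c → Fixed d → ∀ x → twist d c (twist c d x) ≡ x
    twist-inverse {c} {d} c+d≡1 σc σd x = begin
      d * σ (twist c d x) + c * σ (σ² (twist c d x))
        ≡⟨ cong₂ (λ u v → d * u + c * σ v) (σ-twist σc σd x) (σ²-twist σc σd x) ⟩
      d * (c * σ² x + d * x) + c * σ (twist d c x)
        ≡⟨ cong (λ u → d * (c * σ² x + d * x) + c * u) (σ-twist σd σc x) ⟩
      d * (c * σ² x + d * x) + c * (d * σ² x + c * x)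
        ≡⟨ solve 4 (λ c d x y → d :* (c :* y :+ d :* x) :+ c :* (d :* y :+ c :* x) := (c :+ d) :* (c :+ d) :* x)
                   refl c d x (σ² x) ⟩
      (c + d) * (c + d) * x            ≡⟨ cong (λ e → e * e * x) c+d≡1 ⟩
      1# * 1# * x                      ≡⟨ solve 1 (λ x → con 1 :* con 1 :* x := x) refl x ⟩
      x                                ∎

    σ²+twist+twist≡T : ∀ {c d} → c + d ≡ 1# → ∀ x → σ² x + twist c d x + twist d c x ≡ T x
    σ²+twist+twist≡T {c} {d} c+d≡1 x = begin
      σ² x + twist c d x + twist d c x        ≡⟨ solve 5 (λ c d a b e → b :+ (c :* a :+ d :* e) :+ (d :* a :+ c :* e)
                                                                   := (c :+ d) :* a :+ b :+ (c :+ d) :* e)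
                                                         refl c d (σ x) (σ² x) (σ³ x) ⟩
      (c + d) * σ x + σ² x + (c + d) * σ³ x   ≡⟨ cong (λ e → e * σ x + σ² x + e * σ³ x) c+d≡1 ⟩
      1# * σ x + σ² x + 1# * σ³ x             ≡⟨ cong₂ (λ u v → u + σ² x + v) (*-identityˡ (σ x)) (*-identityˡ (σ³ x)) ⟩
      T x                                     ∎

    σ≡σ³⇒σ²-fixed : ∀ {x} → σ x ≡ σ³ x → σ² x ≡ x
    σ≡σ³⇒σ²-fixed {x} e = trans (cong σ e) (σ⁴≡id x)

    twist≡twist⇒σ²-fixed : ∀ {c d x} → c + d ≡ 1# → twist c d x ≡ twist d c x → σ² x ≡ x
    twist≡twist⇒σ²-fixed {c} {d} {x} c+d≡1 e = σ≡σ³⇒σ²-fixed (x+y≡0⇒x≡y (begin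
      σ x + σ³ x                     ≡⟨ solve 2 (λ a b → a :+ b := con 1 :* (a :+ b)) refl (σ x) (σ³ x) ⟩
      1# * (σ x + σ³ x)              ≡⟨ cong (_* (σ x + σ³ x)) c+d≡1 ⟨
      (c + d) * (σ x + σ³ x)         ≡⟨ solve 4 (λ c d a b → (c :+ d) :* (a :+ b) := (c :* a :+ d :* b) :+ (d :* a :+ c :* b))
                                                refl c d (σ x) (σ³ x) ⟩
      twist c d x + twist d c x      ≡⟨ cong (_+ twist d c x) e ⟩
      twist d c x + twist d c x      ≡⟨ x+x≡0 _ ⟩
      0#                             ∎))

    -- Iterating the relation around σ⁴ = id gives d⁴ v = c⁴ v, while c⁴ + d⁴ = (c + d)⁴ = 1.
    dσv≡cv⇒v≡0 : ∀ {c d v} → c + d ≡ 1# → Fixed c → Fixed d → d * σ v ≡ c * v → v ≡ 0#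
    dσv≡cv⇒v≡0 {c} {d} {v} c+d≡1 σc σd e₀ = begin
      v                                          ≡⟨ solve 1 (λ v → v := con 1 :* (con 1 :* (con 1 :* (con 1 :* v))))
                                                            refl v ⟩
      1# * (1# * (1# * (1# * v)))                ≡⟨ cong (λ e → e * (e * (e * (e * v)))) c+d≡1 ⟨
      (c + d) * ((c + d) * ((c + d) * ((c + d) * v)))
        ≡⟨ solve 3 (λ c d v → (c :+ d) :* ((c :+ d) :* ((c :+ d) :* ((c :+ d) :* v)))
                              := d :* (d :* (d :* (d :* v))) :+ c :* (c :* (c :* (c :* v)))) refl c d v ⟩
      d * (d * (d * (d * v))) + c * (c * (c * (c * v))) ≡⟨ cong (_+ c * (c * (c * (c * v)))) d⁴v≡c⁴v ⟩
      c * (c * (c * (c * v))) + c * (c * (c * (c * v))) ≡⟨ x+x≡0 _ ⟩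
      0#                                         ∎
      where
      step : ∀ {u} → d * σ u ≡ c * u → d * σ (σ u) ≡ c * σ u
      step {u} e = begin
        d * σ (σ u)    ≡⟨ cong (_* σ (σ u)) σd ⟨
        σ d * σ (σ u)  ≡⟨ σ-* d (σ u) ⟨
        σ (d * σ u)    ≡⟨ cong σ e ⟩
        σ (c * u)      ≡⟨ σ-* c u ⟩
        σ c * σ u      ≡⟨ cong (_* σ u) σc ⟩
        c * σ u        ∎
      e₁ = step e₀
      e₂ = step e₁
      e₃ = step e₂
      swap : ∀ x y z → x * (y * z) ≡ y * (x * z)
      swap = solve 3 (λ x y z → x :* (y :* z) := y :* (x :* z)) refl
      d⁴v≡c⁴v : d * (d * (d * (d * v))) ≡ c * (c * (c * (c * v)))
      d⁴v≡c⁴v = begin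
        d * (d * (d * (d * v)))            ≡⟨ cong (λ y → d * (d * (d * (d * y)))) (σ⁴≡id v) ⟨
        d * (d * (d * (d * σ (σ³ v))))     ≡⟨ cong (λ y → d * (d * (d * y))) e₃ ⟩
        d * (d * (d * (c * σ³ v)))         ≡⟨ trans (cong (λ y → d * (d * y)) (swap d c _))
                                                    (trans (cong (d *_) (swap d c _)) (swap d c _)) ⟩
        c * (d * (d * (d * σ³ v)))         ≡⟨ cong (λ y → c * (d * (d * y))) e₂ ⟩
        c * (d * (d * (c * σ² v)))         ≡⟨ trans (cong (λ y → c * (d * y)) (swap d c _)) (cong (c *_) (swap d c _)) ⟩
        c * (c * (d * (d * σ² v)))         ≡⟨ cong (λ y → c * (c * (d * y))) e₁ ⟩
        c * (c * (d * (c * σ v)))          ≡⟨ cong (λ y → c * (c * y)) (swap d c _) ⟩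
        c * (c * (c * (d * σ v)))          ≡⟨ cong (λ y → c * (c * (c * y))) e₀ ⟩
        c * (c * (c * (c * v)))            ∎

    σ²≡twist⇒σ²-fixed : ∀ {c d x} → c + d ≡ 1# → Fixed c → Fixed d → σ² x ≡ twist c d x → σ² x ≡ x
    σ²≡twist⇒σ²-fixed {c} {d} {x} c+d≡1 σc σd e = σ≡σ³⇒σ²-fixed (trans σx≡σ²x (cong σ σx≡σ²x))
      where
      v = σ x + σ² x
      dσv≡cv : d * σ v ≡ c * v
      dσv≡cv = x+y≡0⇒x≡y (begin
        d * σ v + c * v                          ≡⟨ cong (λ y → d * y + c * v) (σ-+ (σ x) (σ² x)) ⟩
        d * (σ² x + σ³ x) + c * (σ x + σ² x)     ≡⟨ solve 5 (λ c d a b e → d :* (b :+ e) :+ c :* (a :+ b)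
                                                                       := (c :+ d) :* b :+ (c :* a :+ d :* e))
                                                           refl c d (σ x) (σ² x) (σ³ x) ⟩
        (c + d) * σ² x + twist c d x             ≡⟨ cong₂ (λ e y → e * σ² x + y) c+d≡1 (sym e) ⟩
        1# * σ² x + σ² x                         ≡⟨ solve 1 (λ b → con 1 :* b :+ b := con 0) refl (σ² x) ⟩
        0#                                       ∎)
      σx≡σ²x : σ x ≡ σ² x
      σx≡σ²x = x+y≡0⇒x≡y (dσv≡cv⇒v≡0 c+d≡1 σc σd dσv≡cv)

module FiniteField {n} (K : GF2^ n) where
  open GF2^ K using (Carrier; 0#; 1#; 0≢1; inverse; card; isCommutativeRing; char2) renaming (_^_ to _^ᴷ_)
  open CharacteristicTwo isCommutativeRing char2
  open CommutativeRing commutativeRing using (*-comm; *-assoc; zeroˡ; zeroʳ; +-identityʳ; *-commutativeMonoid)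
  open ≡-Reasoning

  ^ᴷ≡^ : ∀ x k → x ^ᴷ k ≡ x ^ k
  ^ᴷ≡^ x zero    = refl
  ^ᴷ≡^ x (suc k) = cong (x *_) (^ᴷ≡^ x k)

  *-cancelˡ : ∀ {c x y} → c ≢ 0# → c * x ≡ c * y → x ≡ y
  *-cancelˡ {c} {x} {y} c≢0 e with inverse c c≢0
  ... | c⁻¹ , cc⁻¹≡1 = begin
    x                ≡⟨ undo x ⟨
    c⁻¹ * (c * x)    ≡⟨ cong (c⁻¹ *_) e ⟩
    c⁻¹ * (c * y)    ≡⟨ undo y ⟩
    y                ∎
    where
    undo : ∀ z → c⁻¹ * (c * z) ≡ z
    undo z = trans (sym (*-assoc c⁻¹ c z)) (trans (cong (_* z) (trans (*-comm c⁻¹ c) cc⁻¹≡1)) (*-identityˡ z))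

  *-≢0 : ∀ {x y} → x ≢ 0# → y ≢ 0# → x * y ≢ 0#
  *-≢0 {x} x≢0 y≢0 xy≡0 = y≢0 (*-cancelˡ x≢0 (trans xy≡0 (sym (zeroʳ x))))

  _≟_ : DecidableEquality Carrier
  _≟_ = inj⇒≟ (↔⇒↣ card)

  open import Algebra.Properties.CommutativeMonoid.Sum *-commutativeMonoid
    using (sum-cong-≗; sum-permute; ∑-distrib-+; sum-replicate) renaming (sum to prod)

  prod-≢0 : ∀ {k} (g : Fin k → Carrier) → (∀ i → g i ≢ 0#) → prod g ≢ 0#
  prod-≢0 {zero}  g g≢0 1≡0 = 0≢1 (sym 1≡0)
  prod-≢0 {suc k} g g≢0 = *-≢0 (g≢0 fzero) (prod-≢0 (λ i → g (fsuc i)) (λ i → g≢0 (fsuc i)))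

  prod-scale : ∀ {k} c (g : Fin k → Carrier) → prod (λ i → c * g i) ≡ c ^ k * prod g
  prod-scale {k} c g = trans (∑-distrib-+ (λ _ → c) g) (cong (_* prod g) (sum-replicate k))

  module NonzeroElements {Q} (e : Carrier ↔ Fin (suc Q)) where
    open Inverse e using (to; from; strictlyInverseˡ; strictlyInverseʳ)
    open Injection (↔⇒↣ e) using () renaming (injective to to-injective)
    open Injection (↔⇒↣ (↔-sym e)) using () renaming (injective to from-injective)

    nonzero : Fin Q → Carrier
    nonzero i = from (punchIn (to 0#) i)

    nonzero-≢0 : ∀ i → nonzero i ≢ 0#
    nonzero-≢0 i nonzero≡0 = punchInᵢ≢i (to 0#) i (trans (sym (strictlyInverseˡ _)) (cong to nonzero≡0))

    nonzero-injective : ∀ {i j} → nonzero i ≡ nonzero j → i ≡ j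
    nonzero-injective e = punchIn-injective (to 0#) _ _ (from-injective e)

    index : ∀ x → x ≢ 0# → Fin Q
    index x x≢0 = punchOut {i = to 0#} {j = to x} (λ e → x≢0 (to-injective (sym e)))

    nonzero-index : ∀ x (x≢0 : x ≢ 0#) → nonzero (index x x≢0) ≡ x
    nonzero-index x x≢0 = trans (cong from (punchIn-punchOut _)) (strictlyInverseʳ x)

    scale : ∀ c → c ≢ 0# → Fin Q → Fin Q
    scale c c≢0 i = index (c * nonzero i) (*-≢0 c≢0 (nonzero-≢0 i))

    nonzero-scale : ∀ c (c≢0 : c ≢ 0#) i → nonzero (scale c c≢0 i) ≡ c * nonzero i
    nonzero-scale c c≢0 i = nonzero-index (c * nonzero i) (*-≢0 c≢0 (nonzero-≢0 i))

    scale-inverse : ∀ {c d} (c≢0 : c ≢ 0#) (d≢0 : d ≢ 0#) → d * c ≡ 1# →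
                    ∀ i → scale d d≢0 (scale c c≢0 i) ≡ i
    scale-inverse {c} {d} c≢0 d≢0 dc≡1 i = nonzero-injective (begin
      nonzero (scale d d≢0 (scale c c≢0 i))  ≡⟨ nonzero-scale d d≢0 _ ⟩
      d * nonzero (scale c c≢0 i)            ≡⟨ cong (d *_) (nonzero-scale c c≢0 i) ⟩
      d * (c * nonzero i)                    ≡⟨ *-assoc d c _ ⟨
      d * c * nonzero i                      ≡⟨ cong (_* nonzero i) dc≡1 ⟩
      1# * nonzero i                         ≡⟨ *-identityˡ _ ⟩
      nonzero i                              ∎)

    scaling : ∀ c → c ≢ 0# → Permutation Q Q
    scaling c c≢0 with inverse c c≢0
    ... | d , cd≡1 = permutation (scale c c≢0) (scale d d≢0)
                                 (scale-inverse d≢0 c≢0 cd≡1) (scale-inverse c≢0 d≢0 (trans (*-comm d c) cd≡1))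
      where
      d≢0 : d ≢ 0#
      d≢0 d≡0 = 0≢1 (trans (sym (zeroʳ c)) (trans (cong (c *_) (sym d≡0)) cd≡1))

    -- Multiplication by c permutes the nonzero elements, so it fixes their product.
    ^-order≡1 : ∀ {c} → c ≢ 0# → c ^ Q ≡ 1#
    ^-order≡1 {c} c≢0 = *-cancelˡ (prod-≢0 nonzero nonzero-≢0) (begin
      prod nonzero * c ^ Q                    ≡⟨ *-comm _ _ ⟩
      c ^ Q * prod nonzero                    ≡⟨ prod-scale c nonzero ⟨
      prod (λ i → c * nonzero i)              ≡⟨ sum-cong-≗ (nonzero-scale c c≢0) ⟨
      prod (λ i → nonzero (scale c c≢0 i))    ≡⟨ sum-permute nonzero (scaling c c≢0) ⟨
      prod nonzero                            ≡⟨ *-identityʳ _ ⟨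
      prod nonzero * 1#                       ∎)

  x^N≡x : ∀ {N} → Carrier ↔ Fin N → ∀ x → x ^ N ≡ x
  x^N≡x {zero}  e x with () ← Inverse.to e x
  x^N≡x {suc Q} e x with x ≟ 0#
  ... | yes refl = zeroˡ _
  ... | no x≢0   = trans (cong (x *_) (NonzeroElements.^-order≡1 e x≢0)) (*-identityʳ x)

  -- The monic polynomial of degree d whose lower coefficients are listed constant term first.
  evalMonic : ∀ {d} → Vec Carrier d → Carrier → Carrier
  evalMonic []       x = 1#
  evalMonic (c ∷ cs) x = c + x * evalMonic cs x

  -- Synthetic division by X + r, which is X - r in characteristic 2.
  divide : ∀ {d} → Vec Carrier (suc d) → Carrier → Vec Carrier d
  divide (c ∷ [])      r = []
  divide (c ∷ c′ ∷ cs) r = evalMonic (c′ ∷ cs) r ∷ divide (c′ ∷ cs) r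

  evalMonic-divide : ∀ {d} (p : Vec Carrier (suc d)) x r →
                     evalMonic p x ≡ (x + r) * evalMonic (divide p r) x + evalMonic p r
  evalMonic-divide (c ∷ [])      x r =
    solve 3 (λ c x r → c :+ x :* con 1 := (x :+ r) :* con 1 :+ (c :+ r :* con 1)) refl c x r
  evalMonic-divide (c ∷ c′ ∷ cs) x r = begin
    c + x * evalMonic (c′ ∷ cs) x               ≡⟨ cong (λ y → c + x * y) (evalMonic-divide (c′ ∷ cs) x r) ⟩
    c + x * ((x + r) * q + ρ)                    ≡⟨ solve 5 (λ c x r q ρ → c :+ x :* ((x :+ r) :* q :+ ρ)
                                                                := (x :+ r) :* (ρ :+ x :* q) :+ (c :+ r :* ρ))
                                                         refl c x r q ρ ⟩
    (x + r) * (ρ + x * q) + (c + r * ρ)          ∎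
    where
    q = evalMonic (divide (c′ ∷ cs) r) x
    ρ = evalMonic (c′ ∷ cs) r

  divide-root : ∀ {d} (p : Vec Carrier (suc d)) {x r} → x ≢ r →
                evalMonic p r ≡ 0# → evalMonic p x ≡ 0# → evalMonic (divide p r) x ≡ 0#
  divide-root p {x} {r} x≢r pr≡0 px≡0 = *-cancelˡ (λ x+r≡0 → x≢r (x+y≡0⇒x≡y x+r≡0)) (begin
    (x + r) * evalMonic (divide p r) x           ≡⟨ +-identityʳ _ ⟨
    (x + r) * evalMonic (divide p r) x + 0#      ≡⟨ cong ((x + r) * evalMonic (divide p r) x +_) pr≡0 ⟨
    (x + r) * evalMonic (divide p r) x + evalMonic p r ≡⟨ evalMonic-divide p x r ⟨
    evalMonic p x                                ≡⟨ px≡0 ⟩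
    0#                                           ≡⟨ zeroʳ (x + r) ⟨
    (x + r) * 0#                                 ∎)

  roots≤degree : ∀ {d k} (p : Vec Carrier d) (f : Fin k → Carrier) → Injective _≡_ _≡_ f →
                 (∀ i → evalMonic p (f i) ≡ 0#) → k ℕ.≤ d
  roots≤degree {k = zero}      p  f f-inj roots = z≤n
  roots≤degree {zero} {suc k}  [] f f-inj roots = ⊥-elim (0≢1 (sym (roots fzero)))
  roots≤degree {suc d} {suc k} p  f f-inj roots =
    s≤s (roots≤degree (divide p (f fzero)) (λ i → f (fsuc i)) (λ e → suc-injective (f-inj e))
                      (λ i → divide-root p (λ e → fsuc≢fzero (f-inj e)) (roots fzero) (roots (fsuc i))))
    where
    fsuc≢fzero : ∀ {i : Fin k} → fsuc i ≢ fzero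
    fsuc≢fzero ()

  ∃-non-root : ∀ {d} (p : Vec Carrier d) → d ℕ.< 2 ℕ.^ n → ∃ λ x → evalMonic p x ≢ 0#
  ∃-non-root p d<q with ¬∀⟶∃¬ _ (λ i → evalMonic p (from i) ≡ 0#) (λ i → evalMonic p (from i) ≟ 0#) all-roots
    where
    open Inverse card using (from)
    all-roots : ¬ (∀ i → evalMonic p (from i) ≡ 0#)
    all-roots roots = ℕₚ.<⇒≱ d<q (roots≤degree p from (Injection.injective (↔⇒↣ (↔-sym card))) roots)
  ... | i , non-root = Inverse.from card i , non-root

  evalMonic-replicate-0 : ∀ j x → evalMonic (replicate j 0#) x ≡ x ^ j
  evalMonic-replicate-0 zero    x = refl
  evalMonic-replicate-0 (suc j) x = trans (+-identityˡ _) (cong (x *_) (evalMonic-replicate-0 j x))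

  ∃-x^k≢x : ∀ {k} → 2 ℕ.≤ k → k ℕ.< 2 ℕ.^ n → ∃ λ x → x ^ k ≢ x
  ∃-x^k≢x {suc (suc j)} (s≤s (s≤s _)) k<q with ∃-non-root (0# ∷ 1# ∷ replicate j 0#) k<q
  ... | x , non-root = x , λ x^k≡x → non-root (begin
    0# + x * (1# + x * evalMonic (replicate j 0#) x) ≡⟨ cong (λ y → 0# + x * (1# + x * y)) (evalMonic-replicate-0 j x) ⟩
    0# + x * (1# + x * x ^ j)                       ≡⟨ solve 2 (λ x y → con 0 :+ x :* (con 1 :+ x :* y) := x :* (x :* y) :+ x)
                                                               refl x (x ^ j) ⟩
    x ^ suc (suc j) + x                             ≡⟨ cong (_+ x) x^k≡x ⟩
    x + x                                           ≡⟨ x+x≡0 x ⟩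
    0#                                              ∎)

module FrobeniusTriple (m : ℕ) (K : GF2^ (4 ℕ.* m)) (α : GF2^.Carrier K)
    (α-fixed : GF2^._^_ K α (2 ℕ.^ m) ≡ α) where
  open GF2^ K using (Carrier; 1#; card; isCommutativeRing; char2; IsInverseOf; PropertyA; InEUnion)
    renaming (_^_ to _^ᴷ_)
  open CharacteristicTwo isCommutativeRing char2
  open FiniteField K

  σ : Carrier → Carrier
  σ x = x ^ (2 ℕ.^ m)

  iterate-σ : ∀ k x → iterate σ x k ≡ x ^ (2 ℕ.^ (k ℕ.* m))
  iterate-σ zero    x = sym (*-identityʳ x)
  iterate-σ (suc k) x = trans (iterate-σ k (σ x)) (^2^-+ x m (k ℕ.* m))

  open Order4Endomorphism σ (frobenius-+ m) (λ x y → ^-distrib-* x y (2 ℕ.^ m))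
                            (λ x → trans (iterate-σ 4 x) (x^N≡x card x)) public

  β : Carrier
  β = α + 1#

  Φ₁ Φ₂ Φ₃ : Carrier → Carrier
  Φ₁ x = x ^ᴷ (2 ℕ.^ (2 ℕ.* m))
  Φ₂ x = α * x ^ᴷ (2 ℕ.^ m) + β * x ^ᴷ (2 ℕ.^ (3 ℕ.* m))
  Φ₃ x = β * x ^ᴷ (2 ℕ.^ m) + α * x ^ᴷ (2 ℕ.^ (3 ℕ.* m))

  Φ₁≗σ² : ∀ x → Φ₁ x ≡ σ² x
  Φ₁≗σ² x = trans (^ᴷ≡^ x (2 ℕ.^ (2 ℕ.* m))) (sym (iterate-σ 2 x))

  powers≗twist : ∀ c d x → c * x ^ᴷ (2 ℕ.^ m) + d * x ^ᴷ (2 ℕ.^ (3 ℕ.* m)) ≡ twist c d x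
  powers≗twist c d x =
    cong₂ (λ u v → c * u + d * v) (^ᴷ≡^ x (2 ℕ.^ m)) (trans (^ᴷ≡^ x (2 ℕ.^ (3 ℕ.* m))) (sym (iterate-σ 3 x)))

  σα : Fixed α
  σα = trans (sym (^ᴷ≡^ α (2 ℕ.^ m))) α-fixed

  σβ : Fixed β
  σβ = fixed-+ σα (1^n≡1 (2 ℕ.^ m))

  α+β≡1 : α + β ≡ 1#
  α+β≡1 = solve 1 (λ a → a :+ (a :+ con 1) := con 1) refl α

  β+α≡1 : β + α ≡ 1#
  β+α≡1 = solve 1 (λ a → (a :+ con 1) :+ a := con 1) refl α

  inverse-resp-≗ : ∀ {f h g : Carrier → Carrier} → (∀ x → f x ≡ h x) →
                   (∀ x → g (h x) ≡ x) → (∀ y → h (g y) ≡ y) → IsInverseOf g f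
  inverse-resp-≗ {g = g} f≗h gh≗id hg≗id =
    (λ x → trans (cong g (f≗h x)) (gh≗id x)) , (λ y → trans (f≗h (g y)) (hg≗id y))

  Φ₁-inverse : IsInverseOf σ² Φ₁
  Φ₁-inverse = inverse-resp-≗ Φ₁≗σ² σ²-involutive σ²-involutive

  Φ₂-inverse : IsInverseOf (twist β α) Φ₂
  Φ₂-inverse = inverse-resp-≗ (powers≗twist α β) (twist-inverse α+β≡1 σα σβ) (twist-inverse β+α≡1 σβ σα)

  Φ₃-inverse : IsInverseOf (twist α β) Φ₃
  Φ₃-inverse = inverse-resp-≗ (powers≗twist β α) (twist-inverse β+α≡1 σβ σα) (twist-inverse α+β≡1 σα σβ)

  Ψ≗T : ∀ x → Φ₁ x + Φ₂ x + Φ₃ x ≡ T x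
  Ψ≗T x = trans (cong₂ _+_ (cong₂ _+_ (Φ₁≗σ² x) (powers≗twist α β x)) (powers≗twist β α x))
                (σ²+twist+twist≡T α+β≡1 x)

  propertyA : PropertyA Φ₁ Φ₂ Φ₃
  propertyA = σ² , twist β α , twist α β , T , Φ₁-inverse , Φ₂-inverse , Φ₃-inverse ,
              inverse-resp-≗ Ψ≗T T-involutive T-involutive , λ y → sym (σ²+twist+twist≡T β+α≡1 y)

  E∪⇒σ²-fixed : ∀ {x} → InEUnion Φ₁ Φ₂ Φ₃ x → σ² x ≡ x
  E∪⇒σ²-fixed {x} (inj₁ e) =
    σ²≡twist⇒σ²-fixed α+β≡1 σα σβ (trans (sym (Φ₁≗σ² x)) (trans e (powers≗twist α β x)))
  E∪⇒σ²-fixed {x} (inj₂ (inj₁ e)) =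
    σ²≡twist⇒σ²-fixed β+α≡1 σβ σα (trans (sym (Φ₁≗σ² x)) (trans e (powers≗twist β α x)))
  E∪⇒σ²-fixed {x} (inj₂ (inj₂ e)) =
    twist≡twist⇒σ²-fixed α+β≡1 (trans (sym (powers≗twist α β x)) (trans e (powers≗twist β α x)))

  ∃-σ²-moved : 1 ≤ m → ∃ λ x → σ² x ≢ x
  ∃-σ²-moved 1≤m with ∃-x^k≢x 2≤q² q²<q⁴
    where
    instance _ = >-nonZero 1≤m
    2≤q² : 2 ≤ 2 ℕ.^ (2 ℕ.* m)
    2≤q² = ℕₚ.^-monoʳ-≤ 2 (ℕₚ.≤-trans 1≤m (ℕₚ.m≤n*m m 2))
    q²<q⁴ : 2 ℕ.^ (2 ℕ.* m) ℕ.< 2 ℕ.^ (4 ℕ.* m)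
    q²<q⁴ = ℕₚ.^-monoʳ-< 2 (s≤s (s≤s z≤n)) (ℕₚ.*-monoˡ-< m {2} {4} (s≤s (s≤s (s≤s z≤n))))
  ... | x , x^q²≢x = x , λ σ²x≡x → x^q²≢x (trans (sym (iterate-σ 2 x)) σ²x≡x)

  ∃-outside-E∪ : 1 ≤ m → ∃ λ x → ¬ InEUnion Φ₁ Φ₂ Φ₃ x
  ∃-outside-E∪ 1≤m with ∃-σ²-moved 1≤m
  ... | x , σ²x≢x = x , λ x∈E∪ → σ²x≢x (E∪⇒σ²-fixed x∈E∪)

mainTheorem3 : (m : ℕ) → 1 ≤ m → (K : GF2^ (4 ℕ.* m)) →
    let open GF2^ K in
    (α : Carrier) → α ^ (2 ℕ.^ m) ≡ α →
    let Φ₁ = λ x → x ^ (2 ℕ.^ (2 ℕ.* m))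
        Φ₂ = λ x → α * x ^ (2 ℕ.^ m) + (α + 1#) * x ^ (2 ℕ.^ (3 ℕ.* m))
        Φ₃ = λ x → (α + 1#) * x ^ (2 ℕ.^ m) + α * x ^ (2 ℕ.^ (3 ℕ.* m))
    in IsPermutation Φ₁ × IsPermutation Φ₂ × IsPermutation Φ₃ ×
       PropertyA Φ₁ Φ₂ Φ₃ ×
       ∃ (λ x → ¬ InEUnion Φ₁ Φ₂ Φ₃ x)
mainTheorem3 m 1≤m K α α-fixed =
  (σ² , Φ₁-inverse) , (twist β α , Φ₂-inverse) , (twist α β , Φ₃-inverse) , propertyA , ∃-outside-E∪ 1≤m
  where open FrobeniusTriple m K α α-fixed
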